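{- For every integer $m\ge 15$ with $m\notin\{16,17,19,22,23,26,28,29,31,32,34,37\}$, there exists a $3$-way $(v,6,2)$ Steiner trade of volume $m$ (for some $v$).
   Context: For integers $k>t\ge1$, a $3$-way $(v,k,t)$ trade of volume $m$ consists of three pairwise disjoint collections $T_1,T_2,T_3$, each of $m$ blocks ($k$-subsets of a $v$-set $V$), such that every $t$-subset of $V$ is contained in the same number of blocks in each $T_i$. Its foundation $\mathrm{found}(T)$ is the set of points covered by the blocks. It is a Steiner trade if every $t$-subset of $\mathrm{found}(T)$ occurs in at most one block of each $T_i$. -}

module Defs where

open import Data.Nat using (ℕ; zero; suc; _≤_)
open import Data.Bool using (Bool; true; false; _∧_)
open import Data.Fin using (Fin)
open import Data.Fin.Subset using (Subset; ∣_∣; _∈_)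
open import Data.Vec using (lookup)
open import Data.List using (List; []; _∷_; length)
open import Data.List.Membership.Propositional renaming (_∈_ to _∈ₗ_)
open import Data.List.Relation.Unary.All using (All)
open import Data.Product using (Σ; ∃; _×_; _,_)
open import Data.Sum using (_⊎_)
open import Relation.Binary.PropositionalEquality using (_≡_; _≢_)
open import Relation.Nullary using (¬_)

-- A block is a k-subset of the point set V = Fin v.
-- A collection of blocks is a list (multiset) of subsets of Fin v.
Collection : ℕ → Set
Collection v = List (Subset v)

-- number of blocks of T containing both points x and y
-- (i.e. containing the 2-subset {x,y} when x ≢ y)
pairCount : {v : ℕ} → Fin v → Fin v → Collection v → ℕ
pairCount x y [] = 0
pairCount x y (b ∷ T) with lookup b x ∧ lookup b y
... | true  = suc (pairCount x y T)
... | false = pairCount x y T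

AllBlocksSize : {v : ℕ} → ℕ → Collection v → Set
AllBlocksSize k T = All (λ b → ∣ b ∣ ≡ k) T

Disjoint : {v : ℕ} → Collection v → Collection v → Set
Disjoint T U = ∀ b → b ∈ₗ T → ¬ (b ∈ₗ U)

InFound : {v : ℕ} → Fin v → Collection v → Collection v → Collection v → Set
InFound x T₁ T₂ T₃ =
  (Σ _ λ b → b ∈ₗ T₁ × x ∈ b) ⊎ ((Σ _ λ b → b ∈ₗ T₂ × x ∈ b) ⊎ (Σ _ λ b → b ∈ₗ T₃ × x ∈ b))

ThreeWayTrade₂ : (v k m : ℕ) → Collection v → Collection v → Collection v → Set
ThreeWayTrade₂ v k m T₁ T₂ T₃ =
  AllBlocksSize k T₁ × AllBlocksSize k T₂ × AllBlocksSize k T₃ ×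
  length T₁ ≡ m × length T₂ ≡ m × length T₃ ≡ m ×
  Disjoint T₁ T₂ × Disjoint T₁ T₃ × Disjoint T₂ T₃ ×
  (∀ (x y : Fin v) → x ≢ y →
     pairCount x y T₁ ≡ pairCount x y T₂ × pairCount x y T₁ ≡ pairCount x y T₃)

Steiner₂ : {v : ℕ} → Collection v → Collection v → Collection v → Set
Steiner₂ {v} T₁ T₂ T₃ =
  ∀ (x y : Fin v) → x ≢ y → InFound x T₁ T₂ T₃ → InFound y T₁ T₂ T₃ →
    pairCount x y T₁ ≤ 1 × pairCount x y T₂ ≤ 1 × pairCount x y T₃ ≤ 1

Exists3WaySteinerTrade : (k m : ℕ) → Set
Exists3WaySteinerTrade k m =
  Σ ℕ λ v → Σ (Collection v) λ T₁ → Σ (Collection v) λ T₂ → Σ (Collection v) λ T₃ →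
    ThreeWayTrade₂ v k m T₁ T₂ T₃ × Steiner₂ T₁ T₂ T₃

module Submission where

-- Every m ≥ 15 outside the twelve listed exceptions is a sum of the base
-- volumes 15, 18, 20, 21, 24, 25, 27 (a finite table up to 52, then add 15),
-- so it suffices to (1) realise the base volumes and (2) add volumes.
--
-- (1) Grid trades: on Zₙ × {0,…,4} take c ≥ 3 classes of n lines
--     {(a , t + σ(a))}, lines of distinct classes meeting at most once, and c
--     points at infinity.  Collection j extends each line of class s by
--     ∞_{s+j mod c}; pairs of grid points keep their unique line and each
--     (grid point, ∞) pair is covered once, so this is a 3-way Steiner trade
--     of volume c·n.

open import Defs
open import Data.Bool using (true; false; _∧_)
open import Data.Bool.ListAction using (any)
open import Data.Bool.Properties using (∧-comm) renaming (_≟_ to _≟ᵇ_)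
open import Data.Empty using (⊥-elim) renaming (⊥ to Empty)
open import Data.Fin using (Fin; zero; suc; toℕ; _↑ˡ_; _↑ʳ_) renaming (_≟_ to _≟ᶠ_)
open import Data.Fin.Properties using () renaming (all? to allPoints?)
open import Data.Fin.Subset using (Subset; ∣_∣; _∈_; ⊥)
open import Data.Fin.Subset.Properties using (∣⊥∣≡0)
open import Data.List using (List; []; _∷_; _++_; length; map; concat; zipWith; upTo; take; drop; _∷ʳ_)
open import Data.List.Properties using (length-++; length-map)
open import Data.List.Membership.Propositional using () renaming (_∈_ to _∈ₗ_)
open import Data.List.Membership.Propositional.Properties using (∈-map⁻; ∈-++⁻)
open import Data.List.Relation.Unary.All as All using (All; all?)
open import Data.List.Relation.Unary.All.Properties using (map⁺; ++⁺)
open import Data.List.Relation.Unary.Any using (here; there)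
open import Data.Nat using (ℕ; zero; suc; _+_; _*_; _∸_; _%_; _≤_; z≤n; s≤s; NonZero; _≡ᵇ_; _≟_; _≤?_)
open import Data.Nat.Properties using (+-identityʳ; 0≢1+n; m+[n∸m]≡n)
open import Data.Product using (Σ; _×_; _,_; proj₁; proj₂; map₁; map₂)
open import Data.Sum using (_⊎_; inj₁; inj₂; [_,_]′)
open import Data.Vec using (lookup; tabulate) renaming ([] to []ᵛ; _∷_ to _∷ᵛ_; _++_ to _++ᵛ_)
open import Data.Vec.Properties
  using (≡-dec; lookup-++ˡ; lookup-++ʳ; lookup-replicate; ++-injectiveˡ; ++-injectiveʳ; lookup⇒[]=)
open import Function using (_∘_; id)
open import Relation.Binary.PropositionalEquality
  using (_≡_; _≢_; refl; sym; trans; cong; cong₂; subst; module ≡-Reasoning)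
open import Relation.Nullary using (Dec; yes; no; does; ¬?)
open import Relation.Nullary.Decidable using (_×-dec_; _→-dec_)

PairwiseOn : {v : ℕ} → (ℕ → ℕ → ℕ → Set) → Collection v → Collection v → Collection v → Set
PairwiseOn P T₁ T₂ T₃ =
  ∀ x y → x ≢ y → P (pairCount x y T₁) (pairCount x y T₂) (pairCount x y T₃)

Balanced : ℕ → ℕ → ℕ → Set
Balanced a b c = a ≡ b × a ≡ c

AtMostOne : ℕ → ℕ → ℕ → Set
AtMostOne a b c = a ≤ 1 × b ≤ 1 × c ≤ 1

pairCount-++ : ∀ {v} (x y : Fin v) (A B : Collection v) →
  pairCount x y (A ++ B) ≡ pairCount x y A + pairCount x y B
pairCount-++ x y []      B = refl
pairCount-++ x y (b ∷ A) B with lookup b x ∧ lookup b y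
... | true  = cong suc (pairCount-++ x y A B)
... | false = pairCount-++ x y A B

pairCount-comm : ∀ {v} (x y : Fin v) (T : Collection v) → pairCount x y T ≡ pairCount y x T
pairCount-comm x y []      = refl
pairCount-comm x y (b ∷ T) rewrite ∧-comm (lookup b x) (lookup b y) with lookup b y ∧ lookup b x
... | true  = cong suc (pairCount-comm x y T)
... | false = pairCount-comm x y T

pairCount-map : ∀ {v w} (h : Subset w → Subset v) {x y : Fin v} {x′ y′ : Fin w} →
  (∀ a → lookup (h a) x ≡ lookup a x′) → (∀ a → lookup (h a) y ≡ lookup a y′) →
  ∀ A → pairCount x y (map h A) ≡ pairCount x′ y′ A
pairCount-map h hx hy [] = refl
pairCount-map h {x′ = x′} {y′} hx hy (a ∷ A) rewrite hx a | hy a with lookup a x′ ∧ lookup a y′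
... | true  = cong suc (pairCount-map h hx hy A)
... | false = pairCount-map h hx hy A

pairCount-outsideˡ : ∀ {v w} (h : Subset w → Subset v) {x : Fin v} (y : Fin v) →
  (∀ a → lookup (h a) x ≡ false) → ∀ A → pairCount x y (map h A) ≡ 0
pairCount-outsideˡ h y hx []      = refl
pairCount-outsideˡ h y hx (a ∷ A) rewrite hx a = pairCount-outsideˡ h y hx A

pairCount-outsideʳ : ∀ {v w} (h : Subset w → Subset v) (x : Fin v) {y : Fin v} →
  (∀ a → lookup (h a) y ≡ false) → ∀ A → pairCount x y (map h A) ≡ 0
pairCount-outsideʳ h x hy A = trans (pairCount-comm x _ (map h A)) (pairCount-outsideˡ h x hy A)

coveringBlock : ∀ {v} (x y : Fin v) (T : Collection v) → 1 ≤ pairCount x y T →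
  Σ (Subset v) λ b → b ∈ₗ T × x ∈ b × y ∈ b
coveringBlock x y (b ∷ T) covered with lookup b x in bx | lookup b y in by
... | true  | true  = b , here refl , lookup⇒[]= x b bx , lookup⇒[]= y b by
... | true  | false = map₂ (map₁ there) (coveringBlock x y T covered)
... | false | _     = map₂ (map₁ there) (coveringBlock x y T covered)

-- The Steiner condition does not depend on the foundation: a pair with a
-- point outside it is covered by no block, so Steiner₂ amounts to the bound
-- for all pairs of distinct points.  This form is preserved by disjoint unions.
steiner⇒atMostOne : ∀ {v} {T₁ T₂ T₃ : Collection v} →
  Steiner₂ T₁ T₂ T₃ → PairwiseOn AtMostOne T₁ T₂ T₃
steiner⇒atMostOne {v} {T₁} {T₂} {T₃} steiner x y x≢y =
  bounded T₁ (proj₁ ∘ viaBlock inj₁) ,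
  bounded T₂ (proj₁ ∘ proj₂ ∘ viaBlock (inj₂ ∘ inj₁)) ,
  bounded T₃ (proj₂ ∘ proj₂ ∘ viaBlock (inj₂ ∘ inj₂))
  where
  viaBlock : ∀ {T} → (∀ {z} → (Σ (Subset v) λ b → b ∈ₗ T × z ∈ b) → InFound z T₁ T₂ T₃) →
    1 ≤ pairCount x y T → AtMostOne (pairCount x y T₁) (pairCount x y T₂) (pairCount x y T₃)
  viaBlock {T} found covered with coveringBlock x y T covered
  ... | b , b∈T , x∈b , y∈b = steiner x y x≢y (found (b , b∈T , x∈b)) (found (b , b∈T , y∈b))
  bounded : ∀ T → (1 ≤ pairCount x y T → pairCount x y T ≤ 1) → pairCount x y T ≤ 1
  bounded T bound with pairCount x y T
  ... | zero  = z≤n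
  ... | suc _ = bound (s≤s z≤n)

atMostOne⇒steiner : ∀ {v} {T₁ T₂ T₃ : Collection v} →
  PairwiseOn AtMostOne T₁ T₂ T₃ → Steiner₂ T₁ T₂ T₃
atMostOne⇒steiner once x y x≢y _ _ = once x y x≢y

-- No block of T equals a block of U (a decidable form of Disjoint).
Separated : {v : ℕ} → Collection v → Collection v → Set
Separated T U = All (λ b → All (b ≢_) U) T

separated⇒disjoint : ∀ {v} {T U : Collection v} → Separated T U → Disjoint T U
separated⇒disjoint separated b b∈T b∈U = All.lookup (All.lookup separated b∈T) b∈U refl

BalancedAtMostOne : ℕ → ℕ → ℕ → Set
BalancedAtMostOne a b c = a ≡ b × a ≡ c × a ≤ 1

Certificate : (v k m : ℕ) → Collection v → Collection v → Collection v → Set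
Certificate v k m T₁ T₂ T₃ =
  AllBlocksSize k T₁ × AllBlocksSize k T₂ × AllBlocksSize k T₃ ×
  length T₁ ≡ m × length T₂ ≡ m × length T₃ ≡ m ×
  Separated T₁ T₂ × Separated T₁ T₃ × Separated T₂ T₃ ×
  PairwiseOn BalancedAtMostOne T₁ T₂ T₃

certificate? : ∀ {v} (k m : ℕ) (T₁ T₂ T₃ : Collection v) → Dec (Certificate v k m T₁ T₂ T₃)
certificate? k m T₁ T₂ T₃ =
  sizes? T₁ ×-dec sizes? T₂ ×-dec sizes? T₃ ×-dec
  length T₁ ≟ m ×-dec length T₂ ≟ m ×-dec length T₃ ≟ m ×-dec
  separated? T₁ T₂ ×-dec separated? T₁ T₃ ×-dec separated? T₂ T₃ ×-dec
  allPoints? λ x → allPoints? λ y → ¬? (x ≟ᶠ y) →-dec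
    (pairCount x y T₁ ≟ pairCount x y T₂ ×-dec pairCount x y T₁ ≟ pairCount x y T₃ ×-dec
     pairCount x y T₁ ≤? 1)
  where
  sizes? : (T : Collection _) → Dec (AllBlocksSize k T)
  sizes? = all? (λ b → ∣ b ∣ ≟ k)
  separated? : (T U : Collection _) → Dec (Separated T U)
  separated? T U = all? (λ b → all? (λ c → ¬? (≡-dec _≟ᵇ_ b c)) U) T

certificate⇒steinerTrade : ∀ {v k m} {T₁ T₂ T₃ : Collection v} →
  Certificate v k m T₁ T₂ T₃ → ThreeWayTrade₂ v k m T₁ T₂ T₃ × Steiner₂ T₁ T₂ T₃
certificate⇒steinerTrade {T₁ = T₁} {T₂} {T₃} (s₁ , s₂ , s₃ , l₁ , l₂ , l₃ , d₁₂ , d₁₃ , d₂₃ , pairs) =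
  (s₁ , s₂ , s₃ , l₁ , l₂ , l₃ ,
   separated⇒disjoint d₁₂ , separated⇒disjoint d₁₃ , separated⇒disjoint d₂₃ , balanced) ,
  atMostOne⇒steiner atMostOne
  where
  balanced : PairwiseOn Balanced T₁ T₂ T₃
  balanced x y x≢y with pairs x y x≢y
  ... | e₂ , e₃ , _ = e₂ , e₃
  atMostOne : PairwiseOn AtMostOne T₁ T₂ T₃
  atMostOne x y x≢y with pairs x y x≢y
  ... | e₂ , e₃ , ≤1 = ≤1 , subst (_≤ 1) e₂ ≤1 , subst (_≤ 1) e₃ ≤1

fromYes : {P : Set} (decision : Dec P) → does decision ≡ true → P
fromYes (yes p) _  = p
fromYes (no _)  ()

certifiedTrade : ∀ {v} (k m : ℕ) (T₁ T₂ T₃ : Collection v) →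
  does (certificate? k m T₁ T₂ T₃) ≡ true → Exists3WaySteinerTrade k m
certifiedTrade {v} k m T₁ T₂ T₃ accepted =
  v , T₁ , T₂ , T₃ , certificate⇒steinerTrade (fromYes (certificate? k m T₁ T₂ T₃) accepted)

toSubset : (v : ℕ) → List ℕ → Subset v
toSubset v points = tabulate λ i → any (toℕ i ≡ᵇ_) points

-- Grid point (a , t) of Zₙ × {0,…,4} is numbered n·a + t; the line with
-- shift vector σ through column t is {(a , t + σ(a))}.
line : (n : ℕ) .{{_ : NonZero n}} → List ℕ → ℕ → List ℕ
line n σ t = zipWith (λ a s → n * a + (t + s) % n) (upTo (length σ)) σ

-- rotate j [x₀,…,x_{c-1}] has x_{s+j mod c} in position s (for j ≤ c).
rotate : {A : Set} → ℕ → List A → List A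
rotate j xs = drop j xs ++ take j xs

-- One class of lines per shift vector, and one point at infinity per class.
gridPoints : ℕ → List (List ℕ) → ℕ
gridPoints n σs = 5 * n + length σs

-- The j-th collection: each line of class s is extended by ∞_{s+j mod c}.
gridCollection : (n : ℕ) .{{_ : NonZero n}} (σs : List (List ℕ)) → ℕ → Collection (gridPoints n σs)
gridCollection n σs j =
  map (toSubset (gridPoints n σs))
      (concat (zipWith classBlocks σs (rotate j (map (5 * n +_) (upTo (length σs))))))
  where
  classBlocks : List ℕ → ℕ → List (List ℕ)
  classBlocks σ ∞ = map (λ t → line n σ t ∷ʳ ∞) (upTo n)

gridTrade : (n : ℕ) .{{_ : NonZero n}} (σs : List (List ℕ)) →
  does (certificate? 6 (length σs * n)
          (gridCollection n σs 0) (gridCollection n σs 1) (gridCollection n σs 2)) ≡ true →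
  Exists3WaySteinerTrade 6 (length σs * n)
gridTrade n σs = certifiedTrade 6 (length σs * n)
  (gridCollection n σs 0) (gridCollection n σs 1) (gridCollection n σs 2)

-- Shift vectors of the slopes 0,…,c-1: lines of slopes s ≠ s′ meet at most
-- once iff (s − s′)·d ≢ 0 (mod n) for 0 < d < 5; this holds for n = 5, 7, 9.
slopes : ℕ → List (List ℕ)
slopes c = map (λ s → map (s *_) (upTo 5)) (upTo c)

-- Modulo 6 slopes 0 and 2 meet twice, so four shift vectors with pairwise
-- differences injective on {0,…,4} are given explicitly.
shifts₆ : List (List ℕ)
shifts₆ =
  (0 ∷ 0 ∷ 0 ∷ 0 ∷ 0 ∷ []) ∷ (0 ∷ 1 ∷ 2 ∷ 3 ∷ 4 ∷ []) ∷
  (0 ∷ 2 ∷ 4 ∷ 1 ∷ 3 ∷ []) ∷ (0 ∷ 4 ∷ 1 ∷ 5 ∷ 2 ∷ []) ∷ []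

data Side (v₁ v₂ : ℕ) : Fin (v₁ + v₂) → Set where
  left  : (i : Fin v₁) → Side v₁ v₂ (i ↑ˡ v₂)
  right : (j : Fin v₂) → Side v₁ v₂ (v₁ ↑ʳ j)

side : ∀ v₁ v₂ (x : Fin (v₁ + v₂)) → Side v₁ v₂ x
side zero     v₂ x       = right x
side (suc v₁) v₂ zero    = left zero
side (suc v₁) v₂ (suc x) with side v₁ v₂ x
... | left i  = left (suc i)
... | right j = right j

∣++∣ : ∀ {m n} (a : Subset m) (b : Subset n) → ∣ a ++ᵛ b ∣ ≡ ∣ a ∣ + ∣ b ∣
∣++∣ []ᵛ            b = refl
∣++∣ (true  ∷ᵛ a) b = cong suc (∣++∣ a b)
∣++∣ (false ∷ᵛ a) b = ∣++∣ a b

module DisjointUnion {v₁ v₂ : ℕ} where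

  liftˡ : Subset v₁ → Subset (v₁ + v₂)
  liftˡ a = a ++ᵛ ⊥

  liftʳ : Subset v₂ → Subset (v₁ + v₂)
  liftʳ b = ⊥ ++ᵛ b

  infixr 5 _⊕_
  _⊕_ : Collection v₁ → Collection v₂ → Collection (v₁ + v₂)
  A ⊕ B = map liftˡ A ++ map liftʳ B

  liftˡ-left : ∀ a i → lookup (liftˡ a) (i ↑ˡ v₂) ≡ lookup a i
  liftˡ-left a i = lookup-++ˡ a ⊥ i

  liftˡ-right : ∀ a j → lookup (liftˡ a) (v₁ ↑ʳ j) ≡ false
  liftˡ-right a j = trans (lookup-++ʳ a ⊥ j) (lookup-replicate j false)

  liftʳ-left : ∀ b i → lookup (liftʳ b) (i ↑ˡ v₂) ≡ false
  liftʳ-left b i = trans (lookup-++ˡ ⊥ b i) (lookup-replicate i false)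

  liftʳ-right : ∀ b j → lookup (liftʳ b) (v₁ ↑ʳ j) ≡ lookup b j
  liftʳ-right b j = lookup-++ʳ (⊥ {n = v₁}) b j

  sideCount : ∀ {x y} → Side v₁ v₂ x → Side v₁ v₂ y → Collection v₁ → Collection v₂ → ℕ
  sideCount (left i)  (left j)  A B = pairCount i j A
  sideCount (right i) (right j) A B = pairCount i j B
  sideCount _         _         A B = 0

  pairCount-⊕ : ∀ x y A B → pairCount x y (A ⊕ B) ≡ sideCount (side v₁ v₂ x) (side v₁ v₂ y) A B
  pairCount-⊕ x y A B with side v₁ v₂ x | side v₁ v₂ y
  ... | left i  | left j  = begin
    pairCount (i ↑ˡ v₂) (j ↑ˡ v₂) (A ⊕ B)
      ≡⟨ pairCount-++ _ _ (map liftˡ A) (map liftʳ B) ⟩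
    pairCount (i ↑ˡ v₂) (j ↑ˡ v₂) (map liftˡ A) + pairCount (i ↑ˡ v₂) (j ↑ˡ v₂) (map liftʳ B)
      ≡⟨ cong₂ _+_ (pairCount-map liftˡ (λ a → liftˡ-left a i) (λ a → liftˡ-left a j) A)
                   (pairCount-outsideˡ liftʳ _ (λ b → liftʳ-left b i) B) ⟩
    pairCount i j A + 0
      ≡⟨ +-identityʳ _ ⟩
    pairCount i j A ∎
    where open ≡-Reasoning
  ... | right i | right j = trans (pairCount-++ _ _ (map liftˡ A) (map liftʳ B))
    (cong₂ _+_ (pairCount-outsideˡ liftˡ _ (λ a → liftˡ-right a i) A)
               (pairCount-map liftʳ (λ b → liftʳ-right b i) (λ b → liftʳ-right b j) B))
  ... | left i  | right j = trans (pairCount-++ _ _ (map liftˡ A) (map liftʳ B))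
    (cong₂ _+_ (pairCount-outsideʳ liftˡ _ (λ a → liftˡ-right a j) A)
               (pairCount-outsideˡ liftʳ _ (λ b → liftʳ-left b i) B))
  ... | right i | left j  = trans (pairCount-++ _ _ (map liftˡ A) (map liftʳ B))
    (cong₂ _+_ (pairCount-outsideˡ liftˡ _ (λ a → liftˡ-right a i) A)
               (pairCount-outsideʳ liftʳ _ (λ b → liftʳ-left b j) B))

  ⊕-pairwise : (P : ℕ → ℕ → ℕ → Set) → P 0 0 0 →
    ∀ A₁ A₂ A₃ B₁ B₂ B₃ → PairwiseOn P A₁ A₂ A₃ → PairwiseOn P B₁ B₂ B₃ →
    PairwiseOn P (A₁ ⊕ B₁) (A₂ ⊕ B₂) (A₃ ⊕ B₃)
  ⊕-pairwise P P₀ A₁ A₂ A₃ B₁ B₂ B₃ onA onB x y x≢y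
    rewrite pairCount-⊕ x y A₁ B₁ | pairCount-⊕ x y A₂ B₂ | pairCount-⊕ x y A₃ B₃
    with side v₁ v₂ x | side v₁ v₂ y
  ... | left i  | left j  = onA i j (x≢y ∘ cong (_↑ˡ v₂))
  ... | right i | right j = onB i j (x≢y ∘ cong (v₁ ↑ʳ_))
  ... | left _  | right _ = P₀
  ... | right _ | left _  = P₀

  ∣liftˡ∣ : ∀ a → ∣ liftˡ a ∣ ≡ ∣ a ∣
  ∣liftˡ∣ a = trans (∣++∣ a ⊥) (trans (cong (∣ a ∣ +_) (∣⊥∣≡0 v₂)) (+-identityʳ _))

  ∣liftʳ∣ : ∀ b → ∣ liftʳ b ∣ ≡ ∣ b ∣
  ∣liftʳ∣ b = trans (∣++∣ (⊥ {n = v₁}) b) (cong (_+ ∣ b ∣) (∣⊥∣≡0 v₁))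

  ⊕-sizes : ∀ {k A B} → AllBlocksSize k A → AllBlocksSize k B → AllBlocksSize k (A ⊕ B)
  ⊕-sizes sA sB =
    ++⁺ (map⁺ (All.map (λ {a} → trans (∣liftˡ∣ a)) sA))
        (map⁺ (All.map (λ {b} → trans (∣liftʳ∣ b)) sB))

  ⊕-length : ∀ {m n} A B → length A ≡ m → length B ≡ n → length (A ⊕ B) ≡ m + n
  ⊕-length A B refl refl =
    trans (length-++ (map liftˡ A)) (cong₂ _+_ (length-map liftˡ A) (length-map liftʳ B))

  ∈-⊕ : ∀ {b A B} → b ∈ₗ A ⊕ B →
    (Σ _ λ a → a ∈ₗ A × b ≡ liftˡ a) ⊎ (Σ _ λ c → c ∈ₗ B × b ≡ liftʳ c)
  ∈-⊕ {A = A} b∈ with ∈-++⁻ (map liftˡ A) b∈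
  ... | inj₁ b∈A = inj₁ (∈-map⁻ liftˡ b∈A)
  ... | inj₂ b∈B = inj₂ (∈-map⁻ liftʳ b∈B)

  liftˡ≢liftʳ : ∀ {k} a b → ∣ a ∣ ≡ suc k → liftˡ a ≢ liftʳ b
  liftˡ≢liftʳ a b ∣a∣ eq =
    0≢1+n (trans (sym (∣⊥∣≡0 v₁)) (subst (λ s → ∣ s ∣ ≡ _) (++-injectiveˡ a ⊥ eq) ∣a∣))

  ⊕-disjoint : ∀ {k A₁ A₂ B₁ B₂} → AllBlocksSize (suc k) A₁ → AllBlocksSize (suc k) A₂ →
    Disjoint A₁ A₂ → Disjoint B₁ B₂ → Disjoint (A₁ ⊕ B₁) (A₂ ⊕ B₂)
  ⊕-disjoint {A₂ = A₂} {B₂ = B₂} sA₁ sA₂ dA dB b b∈₁ b∈₂ with ∈-⊕ b∈₁ | ∈-⊕ b∈₂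
  ... | inj₁ (a , a∈ , refl) | inj₁ (a′ , a′∈ , eq) =
    dA a a∈ (subst (_∈ₗ A₂) (sym (++-injectiveˡ a a′ eq)) a′∈)
  ... | inj₂ (c , c∈ , refl) | inj₂ (c′ , c′∈ , eq) =
    dB c c∈ (subst (_∈ₗ B₂) (sym (++-injectiveʳ ⊥ ⊥ eq)) c′∈)
  ... | inj₁ (a , a∈ , refl) | inj₂ (c , _ , eq)    = liftˡ≢liftʳ a c (All.lookup sA₁ a∈) eq
  ... | inj₂ (c , _ , refl)  | inj₁ (a , a∈ , eq)   = liftˡ≢liftʳ a c (All.lookup sA₂ a∈) (sym eq)

disjointUnion : ∀ {k m n} → Exists3WaySteinerTrade (suc k) m → Exists3WaySteinerTrade (suc k) n →
  Exists3WaySteinerTrade (suc k) (m + n)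
disjointUnion (v₁ , A₁ , A₂ , A₃ , (sA₁ , sA₂ , sA₃ , lA₁ , lA₂ , lA₃ , dA₁₂ , dA₁₃ , dA₂₃ , balA) , stA)
              (v₂ , B₁ , B₂ , B₃ , (sB₁ , sB₂ , sB₃ , lB₁ , lB₂ , lB₃ , dB₁₂ , dB₁₃ , dB₂₃ , balB) , stB) =
  v₁ + v₂ , A₁ ⊕ B₁ , A₂ ⊕ B₂ , A₃ ⊕ B₃ ,
  (⊕-sizes sA₁ sB₁ , ⊕-sizes sA₂ sB₂ , ⊕-sizes sA₃ sB₃ ,
   ⊕-length A₁ B₁ lA₁ lB₁ , ⊕-length A₂ B₂ lA₂ lB₂ , ⊕-length A₃ B₃ lA₃ lB₃ ,
   ⊕-disjoint sA₁ sA₂ dA₁₂ dB₁₂ , ⊕-disjoint sA₁ sA₃ dA₁₃ dB₁₃ , ⊕-disjoint sA₂ sA₃ dA₂₃ dB₂₃ ,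
   ⊕-pairwise Balanced (refl , refl) A₁ A₂ A₃ B₁ B₂ B₃ balA balB) ,
  atMostOne⇒steiner (⊕-pairwise AtMostOne (z≤n , z≤n , z≤n) A₁ A₂ A₃ B₁ B₂ B₃
                       (steiner⇒atMostOne stA) (steiner⇒atMostOne stB))
  where open DisjointUnion {v₁} {v₂}

SteinerVolume : ℕ → Set
SteinerVolume = Exists3WaySteinerTrade 6

_⊕ᵥ_ : ∀ {m n} → SteinerVolume m → SteinerVolume n → SteinerVolume (m + n)
_⊕ᵥ_ = disjointUnion

volume15 : SteinerVolume 15
volume15 = gridTrade 5 (slopes 3) refl

volume18 : SteinerVolume 18
volume18 = gridTrade 6 (take 3 shifts₆) refl

volume20 : SteinerVolume 20
volume20 = gridTrade 5 (slopes 4) refl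

volume21 : SteinerVolume 21
volume21 = gridTrade 7 (slopes 3) refl

volume24 : SteinerVolume 24
volume24 = gridTrade 6 shifts₆ refl

volume25 : SteinerVolume 25
volume25 = gridTrade 5 (slopes 5) refl

volume27 : SteinerVolume 27
volume27 = gridTrade 9 (slopes 3) refl

pattern add5 k  = suc (suc (suc (suc (suc k))))
pattern add8 k  = suc (suc (suc (add5 k)))
pattern add15 k = add5 (add5 (add5 k))

-- The fifteen volumes 38,…,52 are sums of two base volumes; adding a trade
-- of volume 15 covers everything beyond.
volumesFrom38 : ∀ k → SteinerVolume (38 + k)
volumesFrom38 0         = volume18 ⊕ᵥ volume20
volumesFrom38 1         = volume15 ⊕ᵥ volume24
volumesFrom38 2         = volume15 ⊕ᵥ volume25
volumesFrom38 3         = volume20 ⊕ᵥ volume21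
volumesFrom38 4         = volume15 ⊕ᵥ volume27
volumesFrom38 5         = volume18 ⊕ᵥ volume25
volumesFrom38 6         = volume20 ⊕ᵥ volume24
volumesFrom38 7         = volume18 ⊕ᵥ volume27
volumesFrom38 8         = volume21 ⊕ᵥ volume25
volumesFrom38 9         = volume20 ⊕ᵥ volume27
volumesFrom38 10        = volume21 ⊕ᵥ volume27
volumesFrom38 11        = volume24 ⊕ᵥ volume25
volumesFrom38 12        = volume25 ⊕ᵥ volume25
volumesFrom38 13        = volume24 ⊕ᵥ volume27
volumesFrom38 14        = volume25 ⊕ᵥ volume27
volumesFrom38 (add15 k) = volume15 ⊕ᵥ volumesFrom38 k

data Excluded : ℕ → Set where
  ex16 : Excluded 16
  ex17 : Excluded 17
  ex19 : Excluded 19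
  ex22 : Excluded 22
  ex23 : Excluded 23
  ex26 : Excluded 26
  ex28 : Excluded 28
  ex29 : Excluded 29
  ex31 : Excluded 31
  ex32 : Excluded 32
  ex34 : Excluded 34
  ex37 : Excluded 37

volumeOrExcludedFrom30 : ∀ k → SteinerVolume (30 + k) ⊎ Excluded (30 + k)
volumeOrExcludedFrom30 0        = inj₁ (volume15 ⊕ᵥ volume15)
volumeOrExcludedFrom30 1        = inj₂ ex31
volumeOrExcludedFrom30 2        = inj₂ ex32
volumeOrExcludedFrom30 3        = inj₁ (volume15 ⊕ᵥ volume18)
volumeOrExcludedFrom30 4        = inj₂ ex34
volumeOrExcludedFrom30 5        = inj₁ (volume15 ⊕ᵥ volume20)
volumeOrExcludedFrom30 6        = inj₁ (volume15 ⊕ᵥ volume21)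
volumeOrExcludedFrom30 7        = inj₂ ex37
volumeOrExcludedFrom30 (add8 k) = inj₁ (volumesFrom38 k)

volumeOrExcludedFrom15 : ∀ k → SteinerVolume (15 + k) ⊎ Excluded (15 + k)
volumeOrExcludedFrom15 0         = inj₁ volume15
volumeOrExcludedFrom15 1         = inj₂ ex16
volumeOrExcludedFrom15 2         = inj₂ ex17
volumeOrExcludedFrom15 3         = inj₁ volume18
volumeOrExcludedFrom15 4         = inj₂ ex19
volumeOrExcludedFrom15 5         = inj₁ volume20
volumeOrExcludedFrom15 6         = inj₁ volume21
volumeOrExcludedFrom15 7         = inj₂ ex22
volumeOrExcludedFrom15 8         = inj₂ ex23
volumeOrExcludedFrom15 9         = inj₁ volume24
volumeOrExcludedFrom15 10        = inj₁ volume25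
volumeOrExcludedFrom15 11        = inj₂ ex26
volumeOrExcludedFrom15 12        = inj₁ volume27
volumeOrExcludedFrom15 13        = inj₂ ex28
volumeOrExcludedFrom15 14        = inj₂ ex29
volumeOrExcludedFrom15 (add15 k) = volumeOrExcludedFrom30 k

volumeOrExcluded : ∀ m → 15 ≤ m → SteinerVolume m ⊎ Excluded m
volumeOrExcluded m 15≤m =
  subst (λ n → SteinerVolume n ⊎ Excluded n) (m+[n∸m]≡n 15≤m) (volumeOrExcludedFrom15 (m ∸ 15))

mainTheorem10 : (m : ℕ) → 15 ≤ m →
    m ≢ 16 → m ≢ 17 → m ≢ 19 → m ≢ 22 → m ≢ 23 → m ≢ 26 →
    m ≢ 28 → m ≢ 29 → m ≢ 31 → m ≢ 32 → m ≢ 34 → m ≢ 37 →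
    Exists3WaySteinerTrade 6 m
mainTheorem10 m 15≤m m≢16 m≢17 m≢19 m≢22 m≢23 m≢26 m≢28 m≢29 m≢31 m≢32 m≢34 m≢37 =
  [ id , ⊥-elim ∘ notExcluded refl ]′ (volumeOrExcluded m 15≤m)
  where
  notExcluded : ∀ {n} → n ≡ m → Excluded n → Empty
  notExcluded n≡m ex16 = m≢16 (sym n≡m)
  notExcluded n≡m ex17 = m≢17 (sym n≡m)
  notExcluded n≡m ex19 = m≢19 (sym n≡m)
  notExcluded n≡m ex22 = m≢22 (sym n≡m)
  notExcluded n≡m ex23 = m≢23 (sym n≡m)
  notExcluded n≡m ex26 = m≢26 (sym n≡m)
  notExcluded n≡m ex28 = m≢28 (sym n≡m)
  notExcluded n≡m ex29 = m≢29 (sym n≡m)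
  notExcluded n≡m ex31 = m≢31 (sym n≡m)
  notExcluded n≡m ex32 = m≢32 (sym n≡m)
  notExcluded n≡m ex34 = m≢34 (sym n≡m)
  notExcluded n≡m ex37 = m≢37 (sym n≡m)
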